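{- Let $a,b,m,n$ be positive integers with $m-\varepsilon n=2ab$ and $\gcd(a,m)=\gcd(a,n)=1$, where $\varepsilon\in\{1,-1\}$. Then $$r_m(a)-\varepsilon r_n(a)=\left\lfloor \frac a2\right\rfloor b,$$ where for each positive integer $l$, $$r_l(a)=\left|\left\{r\in\mathbb Z:\ 0<r<\frac l2\ \text{and}\ \left\{\frac{ar}{l}\right\}>\frac12\right\}\right|.$$
   Context: $\lfloor\alpha\rfloor$ and $\{\alpha\}$ denote the integral part and the fractional part of a real number $\alpha$, respectively. -}

module Defs where

open import Data.Nat using (ℕ; zero; suc; _*_; _<_; _<?_)
open import Data.Nat.DivMod using (_%_)
open import Data.List using (List; length; filter; upTo)
open import Relation.Nullary.Decidable using (_×-dec_)

-- Condition defining the set in r_l(a), for a positive modulus l = suc k: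
--   0 < r,  r < l/2  (i.e. 2r < l),  {ar/l} > 1/2  (i.e. l < 2 * ((a*r) mod l)).
-- r_l(a) = number of r ∈ {0,…,l-1} satisfying it (all such r lie in this range).
rCount : ℕ → ℕ → ℕ
rCount zero a = 0
rCount (suc k) a =
  length (filter (λ r → (0 <? r) ×-dec ((2 * r <? suc k) ×-dec (suc k <? 2 * ((a * r) % suc k))))
                 (upTo (suc k)))

{-# OPTIONS --safe #-}
-- For 0 < r < l/2, the condition {ar/l} > 1/2 says that ar/l lies in (i + 1/2, i + 1) for
-- i = ⌊ar/l⌋ < ⌊a/2⌋, so r_l(a) is the sum over i < ⌊a/2⌋ of the number of r with
-- (2i+1)l < 2ar < (2i+2)l. When gcd(a,l) = 1 neither endpoint is a multiple of 2a, so this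
-- number is ⌊(2i+2)l/2a⌋ - ⌊(2i+1)l/2a⌋. If m = n + 2ab then ⌊cm/2a⌋ = ⌊cn/2a⌋ + cb, so each
-- term for m exceeds the one for n by b; if m + n = 2ab then ⌊cm/2a⌋ + ⌊cn/2a⌋ = cb - 1, so
-- the terms for m and n add up to b.
module Submission where

open import Defs

module _ where
  open import Data.Nat
  open import Data.Nat.Properties
  open import Data.Nat.DivMod
  open import Data.Nat.Divisibility using (_∣_; _∤_; divides; n∣m*n; ∣-trans; >⇒∤; *-cancelˡ-∣; m%n≡0⇒n∣m)
  open import Data.Nat.Coprimality using (Coprime; coprime-divisor)
  open import Data.Nat.Tactic.RingSolver using (solve-∀)
  open import Algebra.Properties.CommutativeSemigroup +-commutativeSemigroup using (interchange)
  open import Algebra.Properties.CommutativeSemigroup *-commutativeSemigroup using (x∙yz≈y∙xz; x∙yz≈z∙xy)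
  open import Data.List using (length; filter; upTo; _++_; [_])
  open import Data.List.Properties using (upTo-∷ʳ; filter-++; length-++)
  open import Data.Product using (_×_; _,_; proj₁; proj₂; Σ-syntax)
  open import Function using (_∘_)
  open import Relation.Nullary using (Dec; yes; no; ¬_; contradiction)
  open import Relation.Nullary.Decidable using (_×-dec_)
  open import Relation.Unary using (Pred; Decidable)
  open import Relation.Binary.PropositionalEquality hiding ([_])
  open ≡-Reasoning

  ∑< : ℕ → (ℕ → ℕ) → ℕ
  ∑< zero    f = 0
  ∑< (suc n) f = ∑< n f + f n

  syntax ∑< n (λ i → e) = ∑[ i < n ] e

  ∑-cong : ∀ n {f g : ℕ → ℕ} → (∀ {i} → i < n → f i ≡ g i) → ∑< n f ≡ ∑< n g
  ∑-cong zero    f≗g = refl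
  ∑-cong (suc n) f≗g = cong₂ _+_ (∑-cong n (f≗g ∘ m<n⇒m<1+n)) (f≗g (n<1+n n))

  ∑-const : ∀ n c → ∑[ i < n ] c ≡ n * c
  ∑-const zero    c = refl
  ∑-const (suc n) c = trans (cong (_+ c) (∑-const n c)) (+-comm (n * c) c)

  ∑-distrib-+ : ∀ n (f g : ℕ → ℕ) → ∑[ i < n ] (f i + g i) ≡ ∑< n f + ∑< n g
  ∑-distrib-+ zero    f g = refl
  ∑-distrib-+ (suc n) f g =
    trans (cong (_+ (f n + g n)) (∑-distrib-+ n f g)) (interchange (∑< n f) (∑< n g) (f n) (g n))

  ∑-comm : ∀ m n (f : ℕ → ℕ → ℕ) → ∑[ i < m ] ∑[ j < n ] f i j ≡ ∑[ j < n ] ∑[ i < m ] f i j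
  ∑-comm zero    n f = sym (trans (∑-const n 0) (*-zeroʳ n))
  ∑-comm (suc m) n f = begin
    ∑[ i < m ] ∑[ j < n ] f i j + ∑[ j < n ] f m j  ≡⟨ cong (_+ ∑[ j < n ] f m j) (∑-comm m n f) ⟩
    ∑[ j < n ] ∑[ i < m ] f i j + ∑[ j < n ] f m j  ≡⟨ ∑-distrib-+ n (λ j → ∑[ i < m ] f i j) (f m) ⟨
    ∑[ j < n ] (∑[ i < m ] f i j + f m j)           ∎

  indicator : ∀ {p} {P : Set p} → Dec P → ℕ
  indicator (yes _) = 1
  indicator (no  _) = 0

  indicator-yes : ∀ {p} {P : Set p} (P? : Dec P) → P → indicator P? ≡ 1
  indicator-yes (yes _)  _ = refl
  indicator-yes (no  ¬p) p = contradiction p ¬p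

  indicator-no : ∀ {p} {P : Set p} (P? : Dec P) → ¬ P → indicator P? ≡ 0
  indicator-no (yes p) ¬p = contradiction p ¬p
  indicator-no (no  _) _  = refl

  indicator-cong : ∀ {p q} {P : Set p} {Q : Set q} (P? : Dec P) (Q? : Dec Q) →
                   (P → Q) → (Q → P) → indicator P? ≡ indicator Q?
  indicator-cong (yes p)  Q? to from = sym (indicator-yes Q? (to p))
  indicator-cong (no  ¬p) Q? to from = sym (indicator-no Q? (¬p ∘ from))

  module _ {q} {Q : ℕ → Set q} (Q? : ∀ i → Dec (Q i)) where

    ∑-indicator-none : ∀ n → (∀ {i} → i < n → ¬ Q i) → ∑[ i < n ] indicator (Q? i) ≡ 0
    ∑-indicator-none n none =
      trans (∑-cong n (λ i<n → indicator-no (Q? _) (none i<n))) (trans (∑-const n 0) (*-zeroʳ n))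

    ∑-indicator-unique : ∀ n {j} → j < n → Q j → (∀ {i} → Q i → i ≡ j) → ∑[ i < n ] indicator (Q? i) ≡ 1
    ∑-indicator-unique (suc n) {j} j<1+n qj unique with n ≟ j
    ... | yes refl = cong₂ _+_ (∑-indicator-none n (λ i<n qi → <-irrefl (unique qi) i<n))
                               (indicator-yes (Q? n) qj)
    ... | no  n≢j  = cong₂ _+_ (∑-indicator-unique n (≤∧≢⇒< (s≤s⁻¹ j<1+n) (n≢j ∘ sym)) qj unique)
                               (indicator-no (Q? n) (n≢j ∘ unique))

    indicator≡∑-indicator : ∀ n {p} {P : Set p} (P? : Dec P) →
                            (P → Σ[ i ∈ ℕ ] i < n × Q i) → (∀ {i} → i < n → Q i → P) →
                            (∀ {i j} → Q i → Q j → i ≡ j) →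
                            indicator P? ≡ ∑[ i < n ] indicator (Q? i)
    indicator≡∑-indicator n (yes p) witness _ unique with witness p
    ... | i , i<n , qi = sym (∑-indicator-unique n i<n qi (λ qj → unique qj qi))
    indicator≡∑-indicator n (no ¬p) _ sound _ =
      sym (∑-indicator-none n (λ i<n qi → ¬p (sound i<n qi)))

  length-filter-upTo : ∀ {p} {P : Pred ℕ p} (P? : Decidable P) n →
                       length (filter P? (upTo n)) ≡ ∑[ r < n ] indicator (P? r)
  length-filter-upTo P? zero    = refl
  length-filter-upTo P? (suc n) = begin
    length (filter P? (upTo (suc n)))                       ≡⟨ cong (length ∘ filter P?) (upTo-∷ʳ n) ⟨
    length (filter P? (upTo n ++ [ n ]))                    ≡⟨ cong length (filter-++ P? (upTo n) [ n ]) ⟩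
    length (filter P? (upTo n) ++ filter P? [ n ])          ≡⟨ length-++ (filter P? (upTo n)) ⟩
    length (filter P? (upTo n)) + length (filter P? [ n ])  ≡⟨ cong₂ _+_ (length-filter-upTo P? n) (singleton n) ⟩
    ∑[ r < n ] indicator (P? r) + indicator (P? n)          ∎
    where
    singleton : ∀ x → length (filter P? [ x ]) ≡ indicator (P? x)
    singleton x with P? x
    ... | yes _ = refl
    ... | no  _ = refl

  ∑-indicator-≤ : ∀ n c → ∑[ r < n ] indicator (r ≤? c) ≡ n ⊓ suc c
  ∑-indicator-≤ zero    c = refl
  ∑-indicator-≤ (suc n) c with n ≤? c
  ... | yes n≤c = begin
    ∑[ r < n ] indicator (r ≤? c) + 1  ≡⟨ cong (_+ 1) (∑-indicator-≤ n c) ⟩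
    n ⊓ suc c + 1                      ≡⟨ cong (_+ 1) (m≤n⇒m⊓n≡m (m≤n⇒m≤1+n n≤c)) ⟩
    n + 1                              ≡⟨ +-comm n 1 ⟩
    suc n                              ≡⟨ m≤n⇒m⊓n≡m (s≤s n≤c) ⟨
    suc n ⊓ suc c                      ∎
  ... | no  n≰c = begin
    ∑[ r < n ] indicator (r ≤? c) + 0  ≡⟨ +-identityʳ _ ⟩
    ∑[ r < n ] indicator (r ≤? c)      ≡⟨ ∑-indicator-≤ n c ⟩
    n ⊓ suc c                          ≡⟨ m≥n⇒m⊓n≡n (≰⇒> n≰c) ⟩
    suc c                              ≡⟨ m≥n⇒m⊓n≡n (m≤n⇒m≤1+n (≰⇒> n≰c)) ⟨
    suc n ⊓ suc c                      ∎

  ∑-indicator-interval : ∀ n {u v} → u ≤ v → v < n →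
                         ∑[ r < n ] indicator ((u <? r) ×-dec (r ≤? v)) + u ≡ v
  ∑-indicator-interval n {u} {v} u≤v v<n = suc-injective (begin
    suc (inInterval + u)                                         ≡⟨ cong suc (+-comm inInterval u) ⟩
    suc u + inInterval                                           ≡⟨ cong (_+ inInterval) (m≥n⇒m⊓n≡n (≤-<-trans u≤v v<n)) ⟨
    n ⊓ suc u + inInterval                                       ≡⟨ cong (_+ inInterval) (∑-indicator-≤ n u) ⟨
    ∑[ r < n ] indicator (r ≤? u) + inInterval                   ≡⟨ ∑-distrib-+ n _ _ ⟨
    ∑[ r < n ] (indicator (r ≤? u) + indicator (inInterval? r))  ≡⟨ ∑-cong n (λ _ → split _) ⟨
    ∑[ r < n ] indicator (r ≤? v)                                ≡⟨ ∑-indicator-≤ n v ⟩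
    n ⊓ suc v                                                    ≡⟨ m≥n⇒m⊓n≡n v<n ⟩
    suc v                                                        ∎)
    where
    inInterval? : ∀ r → Dec (u < r × r ≤ v)
    inInterval? r = (u <? r) ×-dec (r ≤? v)

    inInterval : ℕ
    inInterval = ∑[ r < n ] indicator (inInterval? r)

    split : ∀ r → indicator (r ≤? v) ≡ indicator (r ≤? u) + indicator (inInterval? r)
    split r with r ≤? u
    ... | yes r≤u = trans (indicator-yes (r ≤? v) (≤-trans r≤u u≤v))
                          (cong suc (sym (indicator-no (inInterval? r) (λ (u<r , _) → <⇒≱ u<r r≤u))))
    ... | no  r≰u = indicator-cong (r ≤? v) (inInterval? r) (≰⇒> r≰u ,_) proj₂

  module _ {d : ℕ} .{{_ : NonZero d}} where

    /<⇒<* : ∀ {x r} → x / d < r → x < r * d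
    /<⇒<* {x} {r} x/d<r = subst (_< r * d) (sym (m≡m%n+[m/n]*n x d))
      (<-≤-trans (+-monoˡ-< (x / d * d) (m%n<n x d)) (*-monoˡ-≤ d x/d<r))

    *≤⇒≤/ : ∀ {x r} → r * d ≤ x → r ≤ x / d
    *≤⇒≤/ r*d≤x = ≮⇒≥ (λ x/d<r → <⇒≱ (/<⇒<* x/d<r) r*d≤x)

    ≤/⇒*≤ : ∀ {x r} → r ≤ x / d → r * d ≤ x
    ≤/⇒*≤ {x} r≤x/d = ≤-trans (*-monoˡ-≤ d r≤x/d) (m/n*n≤m x d)

    /-unique : ∀ {x q} → q * d ≤ x → x < suc q * d → x / d ≡ q
    /-unique q*d≤x x<[1+q]*d = ≤-antisym (s≤s⁻¹ (m<n*o⇒m/o<n x<[1+q]*d)) (*≤⇒≤/ q*d≤x)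

    [m+kd]/d≡m/d+k : ∀ x k → (x + k * d) / d ≡ x / d + k
    [m+kd]/d≡m/d+k x k = trans (+-distrib-/-∣ʳ x (n∣m*n k)) (cong (x / d +_) (m*n/n≡m k d))

    ∑-indicator-multiples : ∀ n {X Y} → X ≤ Y → Y / d < n → d ∤ Y →
                            ∑[ r < n ] indicator ((X <? r * d) ×-dec (r * d <? Y)) + X / d ≡ Y / d
    ∑-indicator-multiples n {X} {Y} X≤Y Y/d<n d∤Y =
      trans (cong (_+ X / d) (∑-cong n (λ {r} _ → indicator-cong ((X <? r * d) ×-dec (r * d <? Y))
                                                                 ((X / d <? r) ×-dec (r ≤? Y / d)) to from)))
            (∑-indicator-interval n (/-monoˡ-≤ d X≤Y) Y/d<n)
      where
      to : ∀ {r} → X < r * d × r * d < Y → X / d < r × r ≤ Y / d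
      to (X<rd , rd<Y) = m<n*o⇒m/o<n X<rd , *≤⇒≤/ (<⇒≤ rd<Y)
      from : ∀ {r} → X / d < r × r ≤ Y / d → X < r * d × r * d < Y
      from {r} (X/d<r , r≤Y/d) = /<⇒<* X/d<r , ≤∧≢⇒< (≤/⇒*≤ r≤Y/d) (λ rd≡Y → d∤Y (divides r (sym rd≡Y)))

    -- Both remainders are below d and the first is positive, so together they make exactly one d.
    /-complement : ∀ {x y k} → d ∤ x → x + y ≡ k * d → suc (x / d + y / d) ≡ k
    /-complement {x} {y} {k} d∤x x+y≡kd =
      ≤-antisym (*-cancelʳ-< d _ _ kd>qd) (s≤s⁻¹ (*-cancelʳ-< d _ _ kd<[2+q]d))
      where
      q = x / d + y / d
      kd≡[x%d+y%d]+qd : k * d ≡ (x % d + y % d) + q * d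
      kd≡[x%d+y%d]+qd = begin
        k * d                                      ≡⟨ x+y≡kd ⟨
        x + y                                      ≡⟨ cong₂ _+_ (m≡m%n+[m/n]*n x d) (m≡m%n+[m/n]*n y d) ⟩
        (x % d + x / d * d) + (y % d + y / d * d)  ≡⟨ interchange (x % d) _ (y % d) _ ⟩
        (x % d + y % d) + (x / d * d + y / d * d)  ≡⟨ cong (x % d + y % d +_) (*-distribʳ-+ d (x / d) (y / d)) ⟨
        (x % d + y % d) + q * d                    ∎
      x%d>0 : x % d > 0
      x%d>0 = n≢0⇒n>0 (d∤x ∘ m%n≡0⇒n∣m x d)
      kd>qd : q * d < k * d
      kd>qd = subst (q * d <_) (sym kd≡[x%d+y%d]+qd) (m<n+m (q * d) (<-≤-trans x%d>0 (m≤m+n (x % d) (y % d))))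
      kd<[2+q]d : k * d < suc (suc q) * d
      kd<[2+q]d = subst₂ _<_ (sym kd≡[x%d+y%d]+qd) (+-assoc d d (q * d))
                    (+-monoˡ-< (q * d) (+-mono-< (m%n<n x d) (m%n<n y d)))

  [2+2i]l≡2[1+i]l : ∀ i l → (2 + 2 * i) * l ≡ 2 * (suc i * l)
  [2+2i]l≡2[1+i]l i l = trans (cong (_* l) (sym (*-suc 2 i))) (*-assoc 2 (suc i) l)

  InUpperHalf : ℕ → ℕ → ℕ → Set
  InUpperHalf l i x = (1 + 2 * i) * l < 2 * x × 2 * x < (2 + 2 * i) * l

  inUpperHalf? : ∀ l i x → Dec (InUpperHalf l i x)
  inUpperHalf? l i x = ((1 + 2 * i) * l <? 2 * x) ×-dec (2 * x <? (2 + 2 * i) * l)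

  module _ {l : ℕ} .{{_ : NonZero l}} where

    inUpperHalf⇒≡/ : ∀ {i} x → InUpperHalf l i x → i ≡ x / l
    inUpperHalf⇒≡/ {i} x (lower<2x , 2x<upper) = sym (/-unique il≤x x<[1+i]l)
      where
      il≤x : i * l ≤ x
      il≤x = *-cancelˡ-≤ 2 (≤-trans (subst (_≤ (1 + 2 * i) * l) (*-assoc 2 i l) (m≤n+m (2 * i * l) l))
                                    (<⇒≤ lower<2x))
      x<[1+i]l : x < suc i * l
      x<[1+i]l = *-cancelˡ-< 2 x (suc i * l) (subst (2 * x <_) ([2+2i]l≡2[1+i]l i l) 2x<upper)

    module _ (x : ℕ) where

      private
        2x≡2[x%l]+2[x/l]l : 2 * x ≡ 2 * (x % l) + 2 * (x / l) * l
        2x≡2[x%l]+2[x/l]l = trans (cong (2 *_) (m≡m%n+[m/n]*n x l))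
          (trans (*-distribˡ-+ 2 (x % l) (x / l * l)) (cong (2 * (x % l) +_) (sym (*-assoc 2 (x / l) l))))

      l<2[x%l]⇒inUpperHalf : l < 2 * (x % l) → InUpperHalf l (x / l) x
      l<2[x%l]⇒inUpperHalf l<2[x%l] =
          subst ((1 + 2 * (x / l)) * l <_) (sym 2x≡2[x%l]+2[x/l]l) (+-monoˡ-< (2 * (x / l) * l) l<2[x%l])
        , subst₂ _<_ (sym 2x≡2[x%l]+2[x/l]l) (sym (*-distribʳ-+ l 2 (2 * (x / l))))
                 (+-monoˡ-< (2 * (x / l) * l) (*-monoʳ-< 2 (m%n<n x l)))

      inUpperHalf⇒l<2[x%l] : InUpperHalf l (x / l) x → l < 2 * (x % l)
      inUpperHalf⇒l<2[x%l] (lower<2x , _) =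
        +-cancelʳ-< (2 * (x / l) * l) l (2 * (x % l)) (subst ((1 + 2 * (x / l)) * l <_) 2x≡2[x%l]+2[x/l]l lower<2x)

  m<n/2⇒2+2m≤n : ∀ {m n} → m < n / 2 → 2 + 2 * m ≤ n
  m<n/2⇒2+2m≤n {m} {n} m<n/2 = subst (_≤ n) (trans (*-comm (suc m) 2) (*-suc 2 m)) (≤/⇒*≤ {2} m<n/2)

  2+2m≤n⇒m<n/2 : ∀ {m n} → 2 + 2 * m ≤ n → m < n / 2
  2+2m≤n⇒m<n/2 {m} {n} 2+2m≤n = *≤⇒≤/ {2} (subst (_≤ n) (sym (trans (*-comm (suc m) 2) (*-suc 2 m))) 2+2m≤n)

  coprime⇒∤* : ∀ {a l k} → Coprime a l → 0 < k → k < a → a ∤ k * l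
  coprime⇒∤* {a} {l} {k} a⊥l 0<k k<a a∣kl =
    >⇒∤ {{>-nonZero 0<k}} k<a (coprime-divisor a⊥l (subst (a ∣_) (*-comm k l) a∣kl))

  module _ (a : ℕ) .{{_ : NonZero a}} where

    private instance
      2a≢0 : NonZero (2 * a)
      2a≢0 = m*n≢0 2 a

    InR : (l : ℕ) .{{_ : NonZero l}} → ℕ → Set
    InR l r = 0 < r × 2 * r < l × l < 2 * ((a * r) % l)

    inR? : (l : ℕ) .{{_ : NonZero l}} → Decidable (InR l)
    inR? l r = (0 <? r) ×-dec ((2 * r <? l) ×-dec (l <? 2 * ((a * r) % l)))

    rCount≡∑ : ∀ l .{{_ : NonZero l}} → rCount l a ≡ ∑[ r < l ] indicator (inR? l r)
    rCount≡∑ (suc k) = length-filter-upTo (inR? (suc k)) (suc k)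

    module _ {l : ℕ} .{{_ : NonZero l}} where

      inR⇒inUpperHalf : ∀ {r} → InR l r → InUpperHalf l (a * r / l) (a * r)
      inR⇒inUpperHalf {r} (_ , _ , l<2[ar%l]) = l<2[x%l]⇒inUpperHalf (a * r) l<2[ar%l]

      inR⇒/<a/2 : ∀ {r} → InR l r → a * r / l < a / 2
      inR⇒/<a/2 {r} inR@(_ , 2r<l , _) = 2+2m≤n⇒m<n/2 (*-cancelʳ-< l _ a (<-trans lower<2ar 2ar<al))
        where
        lower<2ar = proj₁ (inR⇒inUpperHalf inR)
        2ar<al : 2 * (a * r) < a * l
        2ar<al = subst (_< a * l) (x∙yz≈y∙xz a 2 r) (*-monoʳ-< a 2r<l)

      inUpperHalf⇒inR : ∀ {i r} → i < a / 2 → InUpperHalf l i (a * r) → InR l r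
      inUpperHalf⇒inR {i} {r} i<a/2 inUpperHalf@(lower<2ar , 2ar<upper) =
        positive r lower<2ar , 2r<l , inUpperHalf⇒l<2[x%l] (a * r) inUpperHalf[ar/l]
        where
        positive : ∀ r → (1 + 2 * i) * l < 2 * (a * r) → 0 < r
        positive zero    lower<0 = contradiction (subst ((1 + 2 * i) * l <_) (cong (2 *_) (*-zeroʳ a)) lower<0) n≮0
        positive (suc _) _       = z<s
        inUpperHalf[ar/l] : InUpperHalf l (a * r / l) (a * r)
        inUpperHalf[ar/l] = subst (λ j → InUpperHalf l j (a * r)) (inUpperHalf⇒≡/ {i = i} (a * r) inUpperHalf) inUpperHalf
        2r<l : 2 * r < l
        2r<l = *-cancelˡ-< a (2 * r) l (subst (_< a * l) (sym (x∙yz≈y∙xz a 2 r))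
                 (<-≤-trans 2ar<upper (*-monoˡ-≤ l (m<n/2⇒2+2m≤n {n = a} i<a/2))))

    upperHalfCount : (l : ℕ) .{{_ : NonZero l}} → ℕ → ℕ
    upperHalfCount l i = ∑[ r < l ] indicator (inUpperHalf? l i (a * r))

    rCount≡∑upperHalfCount : ∀ l .{{_ : NonZero l}} → rCount l a ≡ ∑[ i < a / 2 ] upperHalfCount l i
    rCount≡∑upperHalfCount l = begin
      rCount l a                                                      ≡⟨ rCount≡∑ l ⟩
      ∑[ r < l ] indicator (inR? l r)                                 ≡⟨ ∑-cong l (λ {r} _ → indicator-inR≡∑ r) ⟩
      ∑[ r < l ] ∑[ i < a / 2 ] indicator (inUpperHalf? l i (a * r))  ≡⟨ ∑-comm l (a / 2) _ ⟩
      ∑[ i < a / 2 ] upperHalfCount l i                               ∎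
      where
      witness : ∀ {r} → InR l r → Σ[ i ∈ ℕ ] i < a / 2 × InUpperHalf l i (a * r)
      witness {r} inR = a * r / l , inR⇒/<a/2 inR , inR⇒inUpperHalf inR
      unique : ∀ {r i j} → InUpperHalf l i (a * r) → InUpperHalf l j (a * r) → i ≡ j
      unique {r} {i} {j} inI inJ = trans (inUpperHalf⇒≡/ {i = i} (a * r) inI) (sym (inUpperHalf⇒≡/ {i = j} (a * r) inJ))
      indicator-inR≡∑ : ∀ r → indicator (inR? l r) ≡ ∑[ i < a / 2 ] indicator (inUpperHalf? l i (a * r))
      indicator-inR≡∑ r = indicator≡∑-indicator (λ i → inUpperHalf? l i (a * r)) (a / 2) (inR? l r)
                                                witness inUpperHalf⇒inR (unique {r})

    module _ {l : ℕ} .{{_ : NonZero l}} (a⊥l : Coprime a l) {i : ℕ} (i<a/2 : i < a / 2) where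

      private
        2+2i≤a : 2 + 2 * i ≤ a
        2+2i≤a = m<n/2⇒2+2m≤n {n = a} i<a/2

        1+i<a : 1 + i < a
        1+i<a = ≤-trans (+-monoʳ-≤ 2 (m≤n*m i 2)) 2+2i≤a

      2a∤[1+2i]l : 2 * a ∤ (1 + 2 * i) * l
      2a∤[1+2i]l 2a∣[1+2i]l = coprime⇒∤* a⊥l z<s 2+2i≤a (∣-trans (n∣m*n 2) 2a∣[1+2i]l)

      2a∤[2+2i]l : 2 * a ∤ (2 + 2 * i) * l
      2a∤[2+2i]l 2a∣[2+2i]l =
        coprime⇒∤* a⊥l z<s 1+i<a (*-cancelˡ-∣ 2 (subst (2 * a ∣_) ([2+2i]l≡2[1+i]l i l) 2a∣[2+2i]l))

      upperHalfCount-floors : upperHalfCount l i + (1 + 2 * i) * l / (2 * a) ≡ (2 + 2 * i) * l / (2 * a)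
      upperHalfCount-floors =
        trans (cong (_+ (1 + 2 * i) * l / (2 * a)) (∑-cong l (λ {r} _ → indicator-cong _ _ (subst Window (2[ar]≡r[2a] r))
                                                                                          (subst Window (sym (2[ar]≡r[2a] r))))))
              (∑-indicator-multiples l (*-monoˡ-≤ l (n≤1+n (1 + 2 * i))) upper/2a<l 2a∤[2+2i]l)
        where
        Window : ℕ → Set
        Window y = (1 + 2 * i) * l < y × y < (2 + 2 * i) * l
        2[ar]≡r[2a] : ∀ r → 2 * (a * r) ≡ r * (2 * a)
        2[ar]≡r[2a] r = x∙yz≈z∙xy 2 a r
        2+2i<2a : 2 + 2 * i < 2 * a
        2+2i<2a = subst (_< 2 * a) (*-suc 2 i) (*-monoʳ-< 2 1+i<a)
        upper/2a<l : (2 + 2 * i) * l / (2 * a) < l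
        upper/2a<l = m<n*o⇒m/o<n (subst ((2 + 2 * i) * l <_) (*-comm (2 * a) l) (*-monoˡ-< l 2+2i<2a))

    module _ {m n : ℕ} .{{_ : NonZero m}} .{{_ : NonZero n}} (a⊥m : Coprime a m) (a⊥n : Coprime a n) {b : ℕ} where

      upperHalfCount-shift : m ≡ 2 * a * b + n → ∀ {i} → i < a / 2 → upperHalfCount m i ≡ upperHalfCount n i + b
      upperHalfCount-shift m≡2ab+n {i} i<a/2 = +-cancelʳ-≡ (lowerₙ + (1 + 2 * i) * b) _ _ (begin
        upperHalfCount m i + (lowerₙ + (1 + 2 * i) * b)      ≡⟨ cong (upperHalfCount m i +_) (shift (1 + 2 * i)) ⟨
        upperHalfCount m i + (1 + 2 * i) * m / (2 * a)       ≡⟨ upperHalfCount-floors a⊥m i<a/2 ⟩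
        (2 + 2 * i) * m / (2 * a)                            ≡⟨ shift (2 + 2 * i) ⟩
        (2 + 2 * i) * n / (2 * a) + (2 + 2 * i) * b          ≡⟨ cong (_+ (2 + 2 * i) * b) (upperHalfCount-floors a⊥n i<a/2) ⟨
        upperHalfCount n i + lowerₙ + (2 + 2 * i) * b        ≡⟨ regroup (upperHalfCount n i) lowerₙ i b ⟩
        upperHalfCount n i + b + (lowerₙ + (1 + 2 * i) * b)  ∎)
        where
        lowerₙ = (1 + 2 * i) * n / (2 * a)
        distrib : ∀ c d b n → c * (d * b + n) ≡ c * n + c * b * d
        distrib = solve-∀
        regroup : ∀ w x i b → w + x + (2 + 2 * i) * b ≡ w + b + (x + (1 + 2 * i) * b)
        regroup = solve-∀
        shift : ∀ c → c * m / (2 * a) ≡ c * n / (2 * a) + c * b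
        shift c = trans (cong (λ y → c * y / (2 * a)) m≡2ab+n)
                        (trans (cong (_/ (2 * a)) (distrib c (2 * a) b n)) ([m+kd]/d≡m/d+k {2 * a} (c * n) (c * b)))

      upperHalfCount-complement : m + n ≡ 2 * a * b → ∀ {i} → i < a / 2 → upperHalfCount m i + upperHalfCount n i ≡ b
      upperHalfCount-complement m+n≡2ab {i} i<a/2 = +-cancelʳ-≡ ((1 + 2 * i) * b) _ _ (begin
        (wₘ + wₙ) + (1 + 2 * i) * b                                  ≡⟨ cong ((wₘ + wₙ) +_) (complement (1 + 2 * i) (2a∤[1+2i]l a⊥n i<a/2)) ⟨
        (wₘ + wₙ) + suc (lower n + lower m)                          ≡⟨ regroup wₘ wₙ (lower m) (lower n) ⟩
        suc ((wₙ + lower n) + (wₘ + lower m))                        ≡⟨ cong suc (cong₂ _+_ (upperHalfCount-floors a⊥n i<a/2) (upperHalfCount-floors a⊥m i<a/2)) ⟩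
        suc ((2 + 2 * i) * n / (2 * a) + (2 + 2 * i) * m / (2 * a))  ≡⟨ complement (2 + 2 * i) (2a∤[2+2i]l a⊥n i<a/2) ⟩
        (2 + 2 * i) * b                                              ∎)
        where
        wₘ = upperHalfCount m i
        wₙ = upperHalfCount n i
        lower : ℕ → ℕ
        lower l = (1 + 2 * i) * l / (2 * a)
        regroup : ∀ w w′ x x′ → (w + w′) + suc (x′ + x) ≡ suc ((w′ + x′) + (w + x))
        regroup = solve-∀
        distrib : ∀ c m n → c * n + c * m ≡ c * (m + n)
        distrib = solve-∀
        reassoc : ∀ c d b → c * (d * b) ≡ c * b * d
        reassoc = solve-∀
        complement : ∀ c → 2 * a ∤ c * n → suc (c * n / (2 * a) + c * m / (2 * a)) ≡ c * b
        complement c 2a∤cn = /-complement 2a∤cn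
          (trans (distrib c m n) (trans (cong (c *_) m+n≡2ab) (reassoc c (2 * a) b)))

    module _ (m n : ℕ) .{{_ : NonZero m}} .{{_ : NonZero n}} (b : ℕ) (a⊥m : Coprime a m) (a⊥n : Coprime a n) where

      rCount-shift : m ≡ 2 * a * b + n → rCount m a ≡ rCount n a + a / 2 * b
      rCount-shift m≡2ab+n = begin
        rCount m a                                            ≡⟨ rCount≡∑upperHalfCount m ⟩
        ∑[ i < a / 2 ] upperHalfCount m i                     ≡⟨ ∑-cong (a / 2) (upperHalfCount-shift a⊥m a⊥n m≡2ab+n) ⟩
        ∑[ i < a / 2 ] (upperHalfCount n i + b)               ≡⟨ ∑-distrib-+ (a / 2) (upperHalfCount n) (λ _ → b) ⟩
        ∑[ i < a / 2 ] upperHalfCount n i + ∑[ i < a / 2 ] b  ≡⟨ cong₂ _+_ (sym (rCount≡∑upperHalfCount n)) (∑-const (a / 2) b) ⟩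
        rCount n a + a / 2 * b                                ∎

      rCount-complement : m + n ≡ 2 * a * b → rCount m a + rCount n a ≡ a / 2 * b
      rCount-complement m+n≡2ab = begin
        rCount m a + rCount n a                                                ≡⟨ cong₂ _+_ (rCount≡∑upperHalfCount m) (rCount≡∑upperHalfCount n) ⟩
        ∑[ i < a / 2 ] upperHalfCount m i + ∑[ i < a / 2 ] upperHalfCount n i  ≡⟨ ∑-distrib-+ (a / 2) (upperHalfCount m) (upperHalfCount n) ⟨
        ∑[ i < a / 2 ] (upperHalfCount m i + upperHalfCount n i)               ≡⟨ ∑-cong (a / 2) (upperHalfCount-complement a⊥m a⊥n m+n≡2ab) ⟩
        ∑[ i < a / 2 ] b                                                       ≡⟨ ∑-const (a / 2) b ⟩
        a / 2 * b                                                              ∎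

open import Data.Nat using (ℕ; _/_; z<s) renaming (_*_ to _*ℕ_; _<_ to _<ℕ_; _+_ to _+ℕ_)
open import Data.Nat.GCD using (gcd)
open import Data.Nat.Coprimality using (gcd≡1⇒coprime)
open import Data.Integer using (ℤ; +_; -_; _-_; _*_; _+_)
open import Data.Integer.Properties using (+-injective; pos-+)
open import Data.Integer.Tactic.RingSolver using (solve-∀)
open import Data.Sum using (_⊎_; inj₁; inj₂)
open import Relation.Binary.PropositionalEquality using (_≡_; refl; sym; trans; cong)

+m-1*+n≡+k⇒m≡k+n : ∀ {m n k} → + m - + 1 * + n ≡ + k → m ≡ k +ℕ n
+m-1*+n≡+k⇒m≡k+n {m} {n} {k} eq = +-injective (trans (x≡[x-1*y]+y (+ m) (+ n)) (trans (cong (_+ + n) eq) (sym (pos-+ k n))))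
  where
  x≡[x-1*y]+y : ∀ x y → x ≡ (x - + 1 * y) + y
  x≡[x-1*y]+y = solve-∀

m≡n+k⇒+m-1*+n≡+k : ∀ {m n k} → m ≡ n +ℕ k → + m - + 1 * + n ≡ + k
m≡n+k⇒+m-1*+n≡+k {n = n} {k} refl = trans (cong (_- + 1 * + n) (pos-+ n k)) ([y+z]-1*y≡z (+ n) (+ k))
  where
  [y+z]-1*y≡z : ∀ y z → (y + z) - + 1 * y ≡ z
  [y+z]-1*y≡z = solve-∀

+m-[-1]*+n≡+[m+n] : ∀ m n → + m - - (+ 1) * + n ≡ + (m +ℕ n)
+m-[-1]*+n≡+[m+n] m n = trans (x-[-1]*y≡x+y (+ m) (+ n)) (sym (pos-+ m n))
  where
  x-[-1]*y≡x+y : ∀ x y → x - - (+ 1) * y ≡ x + y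
  x-[-1]*y≡x+y = solve-∀

theorem3 : (a b m n : ℕ) → 0 <ℕ a → 0 <ℕ b → 0 <ℕ m → 0 <ℕ n →
           (ε : ℤ) → (ε ≡ + 1 ⊎ ε ≡ - (+ 1)) →
           (+ m) - ε * (+ n) ≡ + (2 *ℕ a *ℕ b) →
           gcd a m ≡ 1 → gcd a n ≡ 1 →
           (+ rCount m a) - ε * (+ rCount n a) ≡ + ((a / 2) *ℕ b)
theorem3 a b m n z<s _ z<s z<s _ (inj₁ refl) m-n≡2ab gcd[a,m]≡1 gcd[a,n]≡1 =
  m≡n+k⇒+m-1*+n≡+k (rCount-shift a m n b (gcd≡1⇒coprime gcd[a,m]≡1) (gcd≡1⇒coprime gcd[a,n]≡1)
                                        (+m-1*+n≡+k⇒m≡k+n m-n≡2ab))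
theorem3 a b m n z<s _ z<s z<s _ (inj₂ refl) m+n≡2ab gcd[a,m]≡1 gcd[a,n]≡1 =
  trans (+m-[-1]*+n≡+[m+n] (rCount m a) (rCount n a))
        (cong +_ (rCount-complement a m n b (gcd≡1⇒coprime gcd[a,m]≡1) (gcd≡1⇒coprime gcd[a,n]≡1)
                                    (+-injective (trans (sym (+m-[-1]*+n≡+[m+n] m n)) m+n≡2ab))))
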